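{- Let $\mathbf V$ be a nontrivial variety of closure algebras. Then $\mathbf V$ has the weak disjunction property if and only if $\mathrm{Eq}(B_{\mathtt F})\subseteq\mathbf V$.
   Context: A closure algebra is a Boolean algebra with a map $f$ satisfying $f(0)=0$, $f(a+b)=f(a)+f(b)$, $a\le f(a)$, $f(f(a))\le f(a)$; its dual is $f^\partial(a)=-f(-a)$. $B_{\mathtt F}$ is the complex algebra of the fork frame: power set of $\{u,v,w\}$ with $f(X)=\{x:\exists y\in X,\ x\mathrel Ry\}$, $R$ the reflexive closure of $\{(u,v),(u,w)\}$; $\mathrm{Eq}(B_{\mathtt F})$ is the variety it generates. $\mathbb 2$ denotes the two-element Boolean algebra with the identity as closure operator. $\mathbf V$ has the weak disjunction property if for all terms $\tau_1(x_1,\dots,x_n)$, $\tau_2(y_1,\dots,y_k)$ in the language of closure algebras (the variable lists may share variables): if $\mathbf V\models f^\partial(\tau_1(x_1,\dots,x_n))+f^\partial(\tau_2(y_1,\dots,y_k))\approx 1$, then $\mathbb 2\models\tau_1\approx1$ or $\mathbb 2\models\tau_2\approx 1$. -}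

module Defs where

open import Level using (0ℓ)
open import Data.Nat using (ℕ)
open import Data.Bool using (Bool; true; false)
import Data.Bool as 𝔹
open import Data.Fin using (Fin; zero; suc)
import Data.Fin as Fin
open import Data.Fin.Subset using (Subset)
import Data.Fin.Subset.Properties as SubsetP
open import Data.Vec using (Vec; []; _∷_; tabulate; lookup)
open import Data.List using (List; allFin)
open import Data.Bool.ListAction using (any)
import Data.Bool.Properties as BoolP
open import Data.Product using (Σ; _×_)
open import Data.Sum using (_⊎_)
open import Relation.Nullary using (does)
import Relation.Nullary as Nullary
open import Relation.Binary.PropositionalEquality using (_≡_; refl; cong)
open import Algebra.Lattice.Bundles using (BooleanAlgebra)

record ClosureAlgebra : Set₁ where
  field
    booleanAlgebra : BooleanAlgebra 0ℓ 0ℓ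
  open BooleanAlgebra booleanAlgebra public
  _≤_ : Carrier → Carrier → Set
  a ≤ b = (a ∨ b) ≈ b
  field
    f        : Carrier → Carrier
    f-cong   : ∀ {a b} → a ≈ b → f a ≈ f b
    f-⊥      : f ⊥ ≈ ⊥
    f-∨      : ∀ a b → f (a ∨ b) ≈ (f a ∨ f b)
    f-ext    : ∀ a → a ≤ f a
    f-idem   : ∀ a → f (f a) ≤ f a

data Term : Set where
  var  : ℕ → Term
  𝟘 𝟙  : Term
  _⊕_  : Term → Term → Term
  _⊙_  : Term → Term → Term
  ⊖_   : Term → Term
  𝒇    : Term → Term

𝒇∂ : Term → Term
𝒇∂ t = ⊖ 𝒇 (⊖ t)

module _ (A : ClosureAlgebra) where
  open ClosureAlgebra A

  ⟦_⟧ : Term → (ℕ → Carrier) → Carrier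
  ⟦ var i ⟧ ρ = ρ i
  ⟦ 𝟘 ⟧ ρ = ⊥
  ⟦ 𝟙 ⟧ ρ = ⊤
  ⟦ t ⊕ s ⟧ ρ = ⟦ t ⟧ ρ ∨ ⟦ s ⟧ ρ
  ⟦ t ⊙ s ⟧ ρ = ⟦ t ⟧ ρ ∧ ⟦ s ⟧ ρ
  ⟦ ⊖ t ⟧ ρ = ¬ ⟦ t ⟧ ρ
  ⟦ 𝒇 t ⟧ ρ = f (⟦ t ⟧ ρ)

_⊨_≈ₜ_ : ClosureAlgebra → Term → Term → Set
A ⊨ t ≈ₜ s = ∀ (ρ : ℕ → ClosureAlgebra.Carrier A) →
  ClosureAlgebra._≈_ A (⟦ A ⟧ t ρ) (⟦ A ⟧ s ρ)

-- Varieties, presented (Birkhoff) by a set of defining identities E.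
-- The variety 𝕍 E is the class of closure algebras satisfying all of E.

Identities : Set₁
Identities = Term → Term → Set

_∈𝕍_ : ClosureAlgebra → Identities → Set
A ∈𝕍 E = ∀ t s → E t s → A ⊨ t ≈ₜ s

_⊩_≈ₜ_ : Identities → Term → Term → Set₁
E ⊩ t ≈ₜ s = ∀ (A : ClosureAlgebra) → A ∈𝕍 E → A ⊨ t ≈ₜ s

Nontrivial : Identities → Set₁
Nontrivial E = Σ ClosureAlgebra λ A →
  (A ∈𝕍 E) × Nullary.¬ (ClosureAlgebra._≈_ A (ClosureAlgebra.⊤ A) (ClosureAlgebra.⊥ A))

𝟚 : ClosureAlgebra
𝟚 = record
  { booleanAlgebra = BoolP.∨-∧-booleanAlgebra
  ; f      = λ a → a
  ; f-cong = λ p → p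
  ; f-⊥    = refl
  ; f-∨    = λ _ _ → refl
  ; f-ext  = BoolP.∨-idem
  ; f-idem = BoolP.∨-idem
  }

-- The fork frame F = ({u,v,w}, R), u = 0, v = 1, w = 2,
-- R = reflexive closure of {(u,v),(u,w)}, and its complex algebra B_F.

u v w : Fin 3
u = zero
v = suc zero
w = suc (suc zero)

Rbase : Fin 3 → Fin 3 → Bool
Rbase zero (suc zero)       = true
Rbase zero (suc (suc zero)) = true
Rbase _    _                = false

R : Fin 3 → Fin 3 → Bool
R x y = does (x Fin.≟ y) 𝔹.∨ Rbase x y

fF : Subset 3 → Subset 3
fF X = tabulate λ x → any (λ y → R x y 𝔹.∧ lookup X y) (allFin 3)

private
  BA₃ : BooleanAlgebra 0ℓ 0ℓ
  BA₃ = SubsetP.∪-∩-booleanAlgebra 3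
  open BooleanAlgebra BA₃ using () renaming (_∨_ to _∪_)

  fF-∨ : ∀ X Y → fF (X ∪ Y) ≡ (fF X ∪ fF Y)
  fF-ext : ∀ X → (X ∪ fF X) ≡ fF X
  fF-idem : ∀ X → (fF (fF X) ∪ fF X) ≡ fF X
  fF-∨ (false ∷ false ∷ false ∷ []) (false ∷ false ∷ false ∷ []) = refl
  fF-∨ (false ∷ false ∷ false ∷ []) (false ∷ false ∷ true ∷ []) = refl
  fF-∨ (false ∷ false ∷ false ∷ []) (false ∷ true ∷ false ∷ []) = refl
  fF-∨ (false ∷ false ∷ false ∷ []) (false ∷ true ∷ true ∷ []) = refl
  fF-∨ (false ∷ false ∷ false ∷ []) (true ∷ false ∷ false ∷ []) = refl
  fF-∨ (false ∷ false ∷ false ∷ []) (true ∷ false ∷ true ∷ []) = refl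
  fF-∨ (false ∷ false ∷ false ∷ []) (true ∷ true ∷ false ∷ []) = refl
  fF-∨ (false ∷ false ∷ false ∷ []) (true ∷ true ∷ true ∷ []) = refl
  fF-∨ (false ∷ false ∷ true ∷ []) (false ∷ false ∷ false ∷ []) = refl
  fF-∨ (false ∷ false ∷ true ∷ []) (false ∷ false ∷ true ∷ []) = refl
  fF-∨ (false ∷ false ∷ true ∷ []) (false ∷ true ∷ false ∷ []) = refl
  fF-∨ (false ∷ false ∷ true ∷ []) (false ∷ true ∷ true ∷ []) = refl
  fF-∨ (false ∷ false ∷ true ∷ []) (true ∷ false ∷ false ∷ []) = refl
  fF-∨ (false ∷ false ∷ true ∷ []) (true ∷ false ∷ true ∷ []) = refl
  fF-∨ (false ∷ false ∷ true ∷ []) (true ∷ true ∷ false ∷ []) = refl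
  fF-∨ (false ∷ false ∷ true ∷ []) (true ∷ true ∷ true ∷ []) = refl
  fF-∨ (false ∷ true ∷ false ∷ []) (false ∷ false ∷ false ∷ []) = refl
  fF-∨ (false ∷ true ∷ false ∷ []) (false ∷ false ∷ true ∷ []) = refl
  fF-∨ (false ∷ true ∷ false ∷ []) (false ∷ true ∷ false ∷ []) = refl
  fF-∨ (false ∷ true ∷ false ∷ []) (false ∷ true ∷ true ∷ []) = refl
  fF-∨ (false ∷ true ∷ false ∷ []) (true ∷ false ∷ false ∷ []) = refl
  fF-∨ (false ∷ true ∷ false ∷ []) (true ∷ false ∷ true ∷ []) = refl
  fF-∨ (false ∷ true ∷ false ∷ []) (true ∷ true ∷ false ∷ []) = refl
  fF-∨ (false ∷ true ∷ false ∷ []) (true ∷ true ∷ true ∷ []) = refl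
  fF-∨ (false ∷ true ∷ true ∷ []) (false ∷ false ∷ false ∷ []) = refl
  fF-∨ (false ∷ true ∷ true ∷ []) (false ∷ false ∷ true ∷ []) = refl
  fF-∨ (false ∷ true ∷ true ∷ []) (false ∷ true ∷ false ∷ []) = refl
  fF-∨ (false ∷ true ∷ true ∷ []) (false ∷ true ∷ true ∷ []) = refl
  fF-∨ (false ∷ true ∷ true ∷ []) (true ∷ false ∷ false ∷ []) = refl
  fF-∨ (false ∷ true ∷ true ∷ []) (true ∷ false ∷ true ∷ []) = refl
  fF-∨ (false ∷ true ∷ true ∷ []) (true ∷ true ∷ false ∷ []) = refl
  fF-∨ (false ∷ true ∷ true ∷ []) (true ∷ true ∷ true ∷ []) = refl
  fF-∨ (true ∷ false ∷ false ∷ []) (false ∷ false ∷ false ∷ []) = refl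
  fF-∨ (true ∷ false ∷ false ∷ []) (false ∷ false ∷ true ∷ []) = refl
  fF-∨ (true ∷ false ∷ false ∷ []) (false ∷ true ∷ false ∷ []) = refl
  fF-∨ (true ∷ false ∷ false ∷ []) (false ∷ true ∷ true ∷ []) = refl
  fF-∨ (true ∷ false ∷ false ∷ []) (true ∷ false ∷ false ∷ []) = refl
  fF-∨ (true ∷ false ∷ false ∷ []) (true ∷ false ∷ true ∷ []) = refl
  fF-∨ (true ∷ false ∷ false ∷ []) (true ∷ true ∷ false ∷ []) = refl
  fF-∨ (true ∷ false ∷ false ∷ []) (true ∷ true ∷ true ∷ []) = refl
  fF-∨ (true ∷ false ∷ true ∷ []) (false ∷ false ∷ false ∷ []) = refl
  fF-∨ (true ∷ false ∷ true ∷ []) (false ∷ false ∷ true ∷ []) = refl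
  fF-∨ (true ∷ false ∷ true ∷ []) (false ∷ true ∷ false ∷ []) = refl
  fF-∨ (true ∷ false ∷ true ∷ []) (false ∷ true ∷ true ∷ []) = refl
  fF-∨ (true ∷ false ∷ true ∷ []) (true ∷ false ∷ false ∷ []) = refl
  fF-∨ (true ∷ false ∷ true ∷ []) (true ∷ false ∷ true ∷ []) = refl
  fF-∨ (true ∷ false ∷ true ∷ []) (true ∷ true ∷ false ∷ []) = refl
  fF-∨ (true ∷ false ∷ true ∷ []) (true ∷ true ∷ true ∷ []) = refl
  fF-∨ (true ∷ true ∷ false ∷ []) (false ∷ false ∷ false ∷ []) = refl
  fF-∨ (true ∷ true ∷ false ∷ []) (false ∷ false ∷ true ∷ []) = refl
  fF-∨ (true ∷ true ∷ false ∷ []) (false ∷ true ∷ false ∷ []) = refl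
  fF-∨ (true ∷ true ∷ false ∷ []) (false ∷ true ∷ true ∷ []) = refl
  fF-∨ (true ∷ true ∷ false ∷ []) (true ∷ false ∷ false ∷ []) = refl
  fF-∨ (true ∷ true ∷ false ∷ []) (true ∷ false ∷ true ∷ []) = refl
  fF-∨ (true ∷ true ∷ false ∷ []) (true ∷ true ∷ false ∷ []) = refl
  fF-∨ (true ∷ true ∷ false ∷ []) (true ∷ true ∷ true ∷ []) = refl
  fF-∨ (true ∷ true ∷ true ∷ []) (false ∷ false ∷ false ∷ []) = refl
  fF-∨ (true ∷ true ∷ true ∷ []) (false ∷ false ∷ true ∷ []) = refl
  fF-∨ (true ∷ true ∷ true ∷ []) (false ∷ true ∷ false ∷ []) = refl
  fF-∨ (true ∷ true ∷ true ∷ []) (false ∷ true ∷ true ∷ []) = refl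
  fF-∨ (true ∷ true ∷ true ∷ []) (true ∷ false ∷ false ∷ []) = refl
  fF-∨ (true ∷ true ∷ true ∷ []) (true ∷ false ∷ true ∷ []) = refl
  fF-∨ (true ∷ true ∷ true ∷ []) (true ∷ true ∷ false ∷ []) = refl
  fF-∨ (true ∷ true ∷ true ∷ []) (true ∷ true ∷ true ∷ []) = refl
  fF-ext (false ∷ false ∷ false ∷ []) = refl
  fF-ext (false ∷ false ∷ true ∷ []) = refl
  fF-ext (false ∷ true ∷ false ∷ []) = refl
  fF-ext (false ∷ true ∷ true ∷ []) = refl
  fF-ext (true ∷ false ∷ false ∷ []) = refl
  fF-ext (true ∷ false ∷ true ∷ []) = refl
  fF-ext (true ∷ true ∷ false ∷ []) = refl
  fF-ext (true ∷ true ∷ true ∷ []) = refl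
  fF-idem (false ∷ false ∷ false ∷ []) = refl
  fF-idem (false ∷ false ∷ true ∷ []) = refl
  fF-idem (false ∷ true ∷ false ∷ []) = refl
  fF-idem (false ∷ true ∷ true ∷ []) = refl
  fF-idem (true ∷ false ∷ false ∷ []) = refl
  fF-idem (true ∷ false ∷ true ∷ []) = refl
  fF-idem (true ∷ true ∷ false ∷ []) = refl
  fF-idem (true ∷ true ∷ true ∷ []) = refl

B-F : ClosureAlgebra
B-F = record
  { booleanAlgebra = SubsetP.∪-∩-booleanAlgebra 3
  ; f      = fF
  ; f-cong = cong fF
  ; f-⊥    = refl
  ; f-∨    = fF-∨
  ; f-ext  = fF-ext
  ; f-idem = fF-idem
  }

WeakDisjunctionProperty : Identities → Set₁
WeakDisjunctionProperty E = ∀ (τ₁ τ₂ : Term) →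
  E ⊩ (𝒇∂ τ₁ ⊕ 𝒇∂ τ₂) ≈ₜ 𝟙 →
  (𝟚 ⊨ τ₁ ≈ₜ 𝟙) ⊎ (𝟚 ⊨ τ₂ ≈ₜ 𝟙)

-- Eq(B_F) ⊆ 𝕍 E, where Eq(B_F) is the variety generated by B_F, i.e.
-- (Birkhoff) the class of algebras satisfying every identity valid in B_F.
_∈Eq_ : ClosureAlgebra → ClosureAlgebra → Set
A ∈Eq B = ∀ t s → B ⊨ t ≈ₜ s → A ⊨ t ≈ₜ s

EqBF⊆ : Identities → Set₁
EqBF⊆ E = ∀ (A : ClosureAlgebra) → A ∈Eq B-F → A ∈𝕍 E

-- If Eq(B_F) ⊆ V then B_F ∈ V, and two terms refuted in 𝟚 can be refuted in
-- B_F at the two maximal points v and w, where B_F behaves like 𝟚; then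
-- f∂τ₁ + f∂τ₂ fails at the root u.
--
-- Conversely, every element a of a closure algebra yields three pairwise
-- disjoint elements Pu, Pv, Pw with join ⊤, related under f exactly as the
-- points of the fork: Pv = f∂ f f∂ a, Pw = -f f∂ a, Pu = the rest.  Relative
-- to each Pᵢ, the map X ↦ ⋁_{j ∈ X} Pⱼ evaluates terms as B_F does at i.  So
-- an identity of V failing in B_F at u forces Pu = 0 throughout V, i.e.
-- V ⊨ f∂(f f∂ x) + f∂(f (-x)) ≈ 1, which the weak disjunction property rules
-- out since neither x nor -x is valid in 𝟚 ∈ V.  At v and w an identity of V
-- holds because 𝟚 ∈ V.
{-# OPTIONS --safe #-}
module Submission where

open import Defs
open import Function.Base using (_∘_; id)
open import Function.Bundles using (_⇔_; mk⇔)
open import Data.Nat using (ℕ; zero; suc; _⊔_; _<_; s<s)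
import Data.Nat.Properties as ℕP
open import Data.Bool using (Bool; true; false; not)
import Data.Bool as 𝔹
import Data.Bool.Properties as BoolP
open import Data.Bool.ListAction using (any)
open import Data.Fin using (Fin; zero; suc)
import Data.Fin as Fin
open import Data.Fin.Subset using (Subset; ∁; _∪_)
open import Data.Fin.Subset.Properties using (anySubset?)
open import Data.Vec using (Vec; []; _∷_; lookup)
import Data.Vec.Properties as VecP
open import Data.List using (List; []; _∷_; foldr; map; allFin)
open import Data.List.Membership.Propositional using (_∈_)
open import Data.List.Membership.Propositional.Properties using (∈-allFin)
open import Data.List.Relation.Unary.Any using (here; there)
open import Data.Product using (_,_; ∃)
open import Data.Sum using (_⊎_; inj₁; inj₂)
open import Data.Empty using (⊥-elim)
open import Relation.Nullary using (yes; no; does)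
open import Relation.Binary.PropositionalEquality as ≡
  using (_≡_; _≢_; refl; cong; cong₂)

module ClosureAlgebraProperties (A : ClosureAlgebra) where
  open ClosureAlgebra A renaming (refl to ≈-refl)
  open import Algebra.Lattice.Properties.BooleanAlgebra booleanAlgebra
    hiding (_⊕_)
  open import Relation.Binary.Reasoning.Setoid setoid

  ≤-reflexive : ∀ {x y} → x ≈ y → x ≤ y
  ≤-reflexive {x} x≈y = trans (∨-congʳ x≈y) (∨-idem _)

  ≤-refl : ∀ {x} → x ≤ x
  ≤-refl = ≤-reflexive ≈-refl

  ≤-respʳ-≈ : ∀ {x y z} → y ≈ z → x ≤ y → x ≤ z
  ≤-respʳ-≈ y≈z x≤y = trans (∨-congˡ (sym y≈z)) (trans x≤y y≈z)

  ≤-trans : ∀ {x y z} → x ≤ y → y ≤ z → x ≤ z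
  ≤-trans {x} {y} {z} x≤y y≤z = begin
    x ∨ z       ≈⟨ ∨-congˡ y≤z ⟨
    x ∨ (y ∨ z) ≈⟨ ∨-assoc x y z ⟨
    (x ∨ y) ∨ z ≈⟨ ∨-congʳ x≤y ⟩
    y ∨ z       ≈⟨ y≤z ⟩
    z           ∎

  x≤y⇒x∧y≈x : ∀ {x y} → x ≤ y → x ∧ y ≈ x
  x≤y⇒x∧y≈x {x} {y} x≤y = trans (∧-congˡ (sym x≤y)) (∧-absorbs-∨ x y)

  x≤x∨y : ∀ x y → x ≤ (x ∨ y)
  x≤x∨y x y = trans (sym (∨-assoc x x y)) (∨-congʳ (∨-idem x))

  y≤x∨y : ∀ x y → y ≤ (x ∨ y)
  y≤x∨y x y = ≤-respʳ-≈ (∨-comm y x) (x≤x∨y y x)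

  ¬-antimono-≤ : ∀ {x y} → x ≤ y → (¬ y) ≤ (¬ x)
  ¬-antimono-≤ {x} {y} x≤y = begin
    ¬ y ∨ ¬ x ≈⟨ deMorgan₁ y x ⟨
    ¬ (y ∧ x) ≈⟨ ¬-cong (∧-comm y x) ⟩
    ¬ (x ∧ y) ≈⟨ ¬-cong (x≤y⇒x∧y≈x x≤y) ⟩
    ¬ x       ∎

  x≤¬y⇒x∧y≈⊥ : ∀ {x y} → x ≤ (¬ y) → x ∧ y ≈ ⊥
  x≤¬y⇒x∧y≈⊥ {x} {y} x≤¬y = begin
    x ∧ y         ≈⟨ ∧-congʳ (x≤y⇒x∧y≈x x≤¬y) ⟨
    (x ∧ ¬ y) ∧ y ≈⟨ ∧-assoc x (¬ y) y ⟩
    x ∧ (¬ y ∧ y) ≈⟨ ∧-congˡ (∧-complementˡ y) ⟩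
    x ∧ ⊥         ≈⟨ ∧-zeroʳ x ⟩
    ⊥             ∎

  ¬x≈⊥⇒x≈⊤ : ∀ {x} → ¬ x ≈ ⊥ → x ≈ ⊤
  ¬x≈⊥⇒x≈⊤ {x} ¬x≈⊥ = trans (sym (¬-involutive x)) (trans (¬-cong ¬x≈⊥) ¬⊥≈⊤)

  f-mono-≤ : ∀ {x y} → x ≤ y → f x ≤ f y
  f-mono-≤ {x} {y} x≤y = trans (sym (f-∨ x y)) (f-cong x≤y)

  f-⊤ : f ⊤ ≈ ⊤
  f-⊤ = trans (sym (f-ext ⊤)) (∨-zeroˡ (f ⊤))

  □ : Carrier → Carrier
  □ x = ¬ f (¬ x)

  □x≤x : ∀ x → □ x ≤ x
  □x≤x x = ≤-respʳ-≈ (¬-involutive x) (¬-antimono-≤ (f-ext (¬ x)))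

  □-mono-≤ : ∀ {x y} → x ≤ y → □ x ≤ □ y
  □-mono-≤ = ¬-antimono-≤ ∘ f-mono-≤ ∘ ¬-antimono-≤

  □x≤□□x : ∀ x → □ x ≤ □ (□ x)
  □x≤□□x x = ¬-antimono-≤ (trans (∨-congʳ (f-cong (¬-involutive _))) (f-idem (¬ x)))

  ⌜_⌝ : Bool → Carrier
  ⌜ true ⌝  = ⊤
  ⌜ false ⌝ = ⊥

  ⌜⌝-cong : ∀ {a b} → a ≡ b → ⌜ a ⌝ ≈ ⌜ b ⌝
  ⌜⌝-cong refl = ≈-refl

  ⌜⌝-∨ : ∀ a b → ⌜ a 𝔹.∨ b ⌝ ≈ ⌜ a ⌝ ∨ ⌜ b ⌝
  ⌜⌝-∨ true  b = sym (∨-zeroˡ ⌜ b ⌝)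
  ⌜⌝-∨ false b = sym (∨-identityˡ ⌜ b ⌝)

  ⌜⌝-∧ : ∀ a b → ⌜ a 𝔹.∧ b ⌝ ≈ ⌜ a ⌝ ∧ ⌜ b ⌝
  ⌜⌝-∧ true  b = sym (∧-identityˡ ⌜ b ⌝)
  ⌜⌝-∧ false b = sym (∧-zeroˡ ⌜ b ⌝)

  ⌜⌝-not : ∀ a → ⌜ not a ⌝ ≈ ¬ ⌜ a ⌝
  ⌜⌝-not true  = sym ¬⊤≈⊥
  ⌜⌝-not false = sym ¬⊥≈⊤

  f-⌜⌝ : ∀ a → f ⌜ a ⌝ ≈ ⌜ a ⌝
  f-⌜⌝ true  = f-⊤
  f-⌜⌝ false = f-⊥

  f-⌜⌝∧ : ∀ a x → f (⌜ a ⌝ ∧ x) ≈ ⌜ a ⌝ ∧ f x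
  f-⌜⌝∧ true  x = trans (f-cong (∧-identityˡ x)) (sym (∧-identityˡ (f x)))
  f-⌜⌝∧ false x = trans (f-cong (∧-zeroˡ x)) (trans f-⊥ (sym (∧-zeroˡ (f x))))

  ⟦⟧-⌜⌝ : ∀ t (ρ : ℕ → Bool) → ⟦ A ⟧ t (⌜_⌝ ∘ ρ) ≈ ⌜ ⟦ 𝟚 ⟧ t ρ ⌝
  ⟦⟧-⌜⌝ (var k) ρ = ≈-refl
  ⟦⟧-⌜⌝ 𝟘       ρ = ≈-refl
  ⟦⟧-⌜⌝ 𝟙       ρ = ≈-refl
  ⟦⟧-⌜⌝ (t ⊕ s) ρ =
    trans (∨-cong (⟦⟧-⌜⌝ t ρ) (⟦⟧-⌜⌝ s ρ)) (sym (⌜⌝-∨ (⟦ 𝟚 ⟧ t ρ) (⟦ 𝟚 ⟧ s ρ)))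
  ⟦⟧-⌜⌝ (t ⊙ s) ρ =
    trans (∧-cong (⟦⟧-⌜⌝ t ρ) (⟦⟧-⌜⌝ s ρ)) (sym (⌜⌝-∧ (⟦ 𝟚 ⟧ t ρ) (⟦ 𝟚 ⟧ s ρ)))
  ⟦⟧-⌜⌝ (⊖ t)   ρ = trans (¬-cong (⟦⟧-⌜⌝ t ρ)) (sym (⌜⌝-not (⟦ 𝟚 ⟧ t ρ)))
  ⟦⟧-⌜⌝ (𝒇 t)   ρ = trans (f-cong (⟦⟧-⌜⌝ t ρ)) (f-⌜⌝ (⟦ 𝟚 ⟧ t ρ))

  ⌜⌝-injective : ⊤ ≉ ⊥ → ∀ {a b} → ⌜ a ⌝ ≈ ⌜ b ⌝ → a ≡ b
  ⌜⌝-injective ⊤≉⊥ {true}  {true}  _   = refl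
  ⌜⌝-injective ⊤≉⊥ {true}  {false} ⊤≈⊥ = ⊥-elim (⊤≉⊥ ⊤≈⊥)
  ⌜⌝-injective ⊤≉⊥ {false} {true}  ⊥≈⊤ = ⊥-elim (⊤≉⊥ (sym ⊥≈⊤))
  ⌜⌝-injective ⊤≉⊥ {false} {false} _   = refl

  infix 4 _≈[_]_
  _≈[_]_ : Carrier → Carrier → Carrier → Set
  x ≈[ p ] y = x ∧ p ≈ y ∧ p

  ≈⇒≈[] : ∀ {p x y} → x ≈ y → x ≈[ p ] y
  ≈⇒≈[] = ∧-congʳ

  ∨-cong-≈[] : ∀ {p x x′ y y′} → x ≈[ p ] x′ → y ≈[ p ] y′ → x ∨ y ≈[ p ] x′ ∨ y′
  ∨-cong-≈[] {p} {x} {x′} {y} {y′} x≈x′ y≈y′ = begin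
    (x ∨ y) ∧ p         ≈⟨ ∧-distribʳ-∨ p x y ⟩
    (x ∧ p) ∨ (y ∧ p)   ≈⟨ ∨-cong x≈x′ y≈y′ ⟩
    (x′ ∧ p) ∨ (y′ ∧ p) ≈⟨ ∧-distribʳ-∨ p x′ y′ ⟨
    (x′ ∨ y′) ∧ p       ∎

  ∧-cong-≈[] : ∀ {p x x′ y y′} → x ≈[ p ] x′ → y ≈[ p ] y′ → x ∧ y ≈[ p ] x′ ∧ y′
  ∧-cong-≈[] {p} {x} {x′} {y} {y′} x≈x′ y≈y′ = begin
    (x ∧ y) ∧ p         ≈⟨ ∧-distribʳ-∧ p x y ⟩
    (x ∧ p) ∧ (y ∧ p)   ≈⟨ ∧-cong x≈x′ y≈y′ ⟩
    (x′ ∧ p) ∧ (y′ ∧ p) ≈⟨ ∧-distribʳ-∧ p x′ y′ ⟨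
    (x′ ∧ y′) ∧ p       ∎
    where
    ∧-distribʳ-∧ : ∀ p x y → (x ∧ y) ∧ p ≈ (x ∧ p) ∧ (y ∧ p)
    ∧-distribʳ-∧ p x y = begin
      (x ∧ y) ∧ p       ≈⟨ ∧-congˡ (∧-idem p) ⟨
      (x ∧ y) ∧ (p ∧ p) ≈⟨ ∧-assoc x y (p ∧ p) ⟩
      x ∧ (y ∧ (p ∧ p)) ≈⟨ ∧-congˡ (∧-assoc y p p) ⟨
      x ∧ ((y ∧ p) ∧ p) ≈⟨ ∧-congˡ (∧-comm (y ∧ p) p) ⟩
      x ∧ (p ∧ (y ∧ p)) ≈⟨ ∧-assoc x p (y ∧ p) ⟨
      (x ∧ p) ∧ (y ∧ p) ∎

  ¬-cong-≈[] : ∀ {p x y} → x ≈[ p ] y → ¬ x ≈[ p ] ¬ y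
  ¬-cong-≈[] {p} {x} {y} x≈y = begin
    ¬ x ∧ p       ≈⟨ ¬-relative x ⟩
    ¬ (x ∧ p) ∧ p ≈⟨ ∧-congʳ (¬-cong x≈y) ⟩
    ¬ (y ∧ p) ∧ p ≈⟨ ¬-relative y ⟨
    ¬ y ∧ p       ∎
    where
    ¬-relative : ∀ z → ¬ z ∧ p ≈ ¬ (z ∧ p) ∧ p
    ¬-relative z = sym (begin
      ¬ (z ∧ p) ∧ p         ≈⟨ ∧-congʳ (deMorgan₁ z p) ⟩
      (¬ z ∨ ¬ p) ∧ p       ≈⟨ ∧-distribʳ-∨ p (¬ z) (¬ p) ⟩
      (¬ z ∧ p) ∨ (¬ p ∧ p) ≈⟨ ∨-congˡ (∧-complementˡ p) ⟩
      (¬ z ∧ p) ∨ ⊥         ≈⟨ ∨-identityʳ _ ⟩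
      ¬ z ∧ p               ∎)

  ≤⇒≈[]⊤ : ∀ {p x} → p ≤ x → x ≈[ p ] ⌜ true ⌝
  ≤⇒≈[]⊤ {p} p≤x = trans (∧-comm _ p) (trans (x≤y⇒x∧y≈x p≤x) (sym (∧-identityˡ p)))

  ∧≈⊥⇒≈[]⊥ : ∀ {p x} → x ∧ p ≈ ⊥ → x ≈[ p ] ⌜ false ⌝
  ∧≈⊥⇒≈[]⊥ {p} x∧p≈⊥ = trans x∧p≈⊥ (sym (∧-zeroˡ p))

  ⌜⌝-≈[]-≢⇒≈⊥ : ∀ {p a b} → ⌜ a ⌝ ≈[ p ] ⌜ b ⌝ → a ≢ b → p ≈ ⊥
  ⌜⌝-≈[]-≢⇒≈⊥ {p} {true}  {true}  _ a≢b = ⊥-elim (a≢b refl)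
  ⌜⌝-≈[]-≢⇒≈⊥ {p} {true}  {false} e _   =
    trans (sym (∧-identityˡ p)) (trans e (∧-zeroˡ p))
  ⌜⌝-≈[]-≢⇒≈⊥ {p} {false} {true}  e _   =
    trans (sym (∧-identityˡ p)) (trans (sym e) (∧-zeroˡ p))
  ⌜⌝-≈[]-≢⇒≈⊥ {p} {false} {false} _ a≢b = ⊥-elim (a≢b refl)

  ⋁ : List Carrier → Carrier
  ⋁ = foldr _∨_ ⊥

  module _ {I : Set} where

    ⋁-map-cong : ∀ {g h : I → Carrier} → (∀ j → g j ≈ h j) →
                 ∀ js → ⋁ (map g js) ≈ ⋁ (map h js)
    ⋁-map-cong g≈h []       = ≈-refl
    ⋁-map-cong g≈h (j ∷ js) = ∨-cong (g≈h j) (⋁-map-cong g≈h js)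

    ∧-distribˡ-⋁ : ∀ x (g : I → Carrier) js →
                   x ∧ ⋁ (map g js) ≈ ⋁ (map (λ j → x ∧ g j) js)
    ∧-distribˡ-⋁ x g []       = ∧-zeroʳ x
    ∧-distribˡ-⋁ x g (j ∷ js) =
      trans (∧-distribˡ-∨ x _ _) (∨-congˡ (∧-distribˡ-⋁ x g js))

    f-⋁ : ∀ (g : I → Carrier) js → f (⋁ (map g js)) ≈ ⋁ (map (f ∘ g) js)
    f-⋁ g []       = f-⊥
    f-⋁ g (j ∷ js) = trans (f-∨ _ _) (∨-congˡ (f-⋁ g js))

    ⋁-≈[]-any : ∀ {p} {q : I → Carrier} (d : I → Bool) →
                (∀ j → q j ≈[ p ] ⌜ d j ⌝) → ∀ (b : I → Bool) js →
                ⋁ (map (λ j → ⌜ b j ⌝ ∧ q j) js) ≈[ p ] ⌜ any (λ j → d j 𝔹.∧ b j) js ⌝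
    ⋁-≈[]-any d q≈d b []       = ≈-refl
    ⋁-≈[]-any d q≈d b (j ∷ js) = trans
      (∨-cong-≈[] (∧-cong-≈[] ≈-refl (q≈d j)) (⋁-≈[]-any d q≈d b js))
      (≈⇒≈[] (sym (trans (⌜⌝-∨ (d j 𝔹.∧ b j) (any (λ j → d j 𝔹.∧ b j) js))
        (∨-congʳ (trans (⌜⌝-∧ (d j) (b j)) (∧-comm _ _))))))

  any-diagonal : ∀ i (X : Subset 3) →
                 any (λ j → does (i Fin.≟ j) 𝔹.∧ lookup X j) (allFin 3) ≡ lookup X i
  any-diagonal zero             (x ∷ y ∷ z ∷ []) = BoolP.∨-identityʳ x
  any-diagonal (suc zero)       (x ∷ y ∷ z ∷ []) = BoolP.∨-identityʳ y
  any-diagonal (suc (suc zero)) (x ∷ y ∷ z ∷ []) = BoolP.∨-identityʳ z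

  -- A partition of unity indexed by the fork's points, related under f as
  -- the points are under R, makes X ↦ ⋁_{j ∈ X} Pⱼ a homomorphism from B_F,
  -- which we only need locally below each Pᵢ.
  module ForkPartition
    (P : Fin 3 → Carrier)
    (covers : ⋁ (map P (allFin 3)) ≈ ⊤)
    (disjoint : ∀ i j → P j ≈[ P i ] ⌜ does (i Fin.≟ j) ⌝)
    (f-P : ∀ i j → f (P j) ≈[ P i ] ⌜ R i j ⌝)
    where

    embed : Subset 3 → Carrier
    embed X = ⋁ (map (λ j → ⌜ lookup X j ⌝ ∧ P j) (allFin 3))

    decompose : ∀ x → x ≈ ⋁ (map (λ j → x ∧ P j) (allFin 3))
    decompose x = begin
      x                            ≈⟨ ∧-identityʳ x ⟨
      x ∧ ⊤                        ≈⟨ ∧-congˡ covers ⟨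
      x ∧ ⋁ (map P (allFin 3))     ≈⟨ ∧-distribˡ-⋁ x P (allFin 3) ⟩
      ⋁ (map (λ j → x ∧ P j) (allFin 3)) ∎

    ⟦⟧-embed : ∀ t (ρ : ℕ → Subset 3) i →
               ⟦ A ⟧ t (embed ∘ ρ) ≈[ P i ] ⌜ lookup (⟦ B-F ⟧ t ρ) i ⌝
    ⟦⟧-embed (var k) ρ i =
      trans (⋁-≈[]-any (λ j → does (i Fin.≟ j)) (disjoint i) (lookup (ρ k)) (allFin 3))
            (≈⇒≈[] (⌜⌝-cong (any-diagonal i (ρ k))))
    ⟦⟧-embed 𝟘 ρ i = ≈⇒≈[] (⌜⌝-cong (≡.sym (VecP.lookup-replicate i false)))
    ⟦⟧-embed 𝟙 ρ i = ≈⇒≈[] (⌜⌝-cong (≡.sym (VecP.lookup-replicate i true)))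
    ⟦⟧-embed (t ⊕ s) ρ i = trans (∨-cong-≈[] (⟦⟧-embed t ρ i) (⟦⟧-embed s ρ i))
      (≈⇒≈[] (trans (sym (⌜⌝-∨ (lookup X i) (lookup Y i)))
        (⌜⌝-cong (≡.sym (VecP.lookup-zipWith 𝔹._∨_ i X Y)))))
      where X = ⟦ B-F ⟧ t ρ; Y = ⟦ B-F ⟧ s ρ
    ⟦⟧-embed (t ⊙ s) ρ i = trans (∧-cong-≈[] (⟦⟧-embed t ρ i) (⟦⟧-embed s ρ i))
      (≈⇒≈[] (trans (sym (⌜⌝-∧ (lookup X i) (lookup Y i)))
        (⌜⌝-cong (≡.sym (VecP.lookup-zipWith 𝔹._∧_ i X Y)))))
      where X = ⟦ B-F ⟧ t ρ; Y = ⟦ B-F ⟧ s ρ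
    ⟦⟧-embed (⊖ t) ρ i = trans (¬-cong-≈[] (⟦⟧-embed t ρ i))
      (≈⇒≈[] (trans (sym (⌜⌝-not (lookup X i)))
        (⌜⌝-cong (≡.sym (VecP.lookup-map i not X)))))
      where X = ⟦ B-F ⟧ t ρ
    ⟦⟧-embed (𝒇 t) ρ i = begin
      f x ∧ P i                                     ≈⟨ ∧-congʳ (f-cong x≈⋁) ⟩
      f (⋁ (map (λ j → ⌜ X j ⌝ ∧ P j) (allFin 3))) ∧ P i
        ≈⟨ ∧-congʳ (f-⋁ (λ j → ⌜ X j ⌝ ∧ P j) (allFin 3)) ⟩
      ⋁ (map (λ j → f (⌜ X j ⌝ ∧ P j)) (allFin 3)) ∧ P i
        ≈⟨ ∧-congʳ (⋁-map-cong (λ j → f-⌜⌝∧ (X j) (P j)) (allFin 3)) ⟩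
      ⋁ (map (λ j → ⌜ X j ⌝ ∧ f (P j)) (allFin 3)) ∧ P i
        ≈⟨ ⋁-≈[]-any (R i) (f-P i) X (allFin 3) ⟩
      ⌜ any (λ j → R i j 𝔹.∧ X j) (allFin 3) ⌝ ∧ P i
        ≈⟨ ∧-congʳ (⌜⌝-cong (≡.sym (VecP.lookup∘tabulate fX i))) ⟩
      ⌜ lookup (⟦ B-F ⟧ (𝒇 t) ρ) i ⌝ ∧ P i ∎
      where
      x = ⟦ A ⟧ t (embed ∘ ρ)
      X = lookup (⟦ B-F ⟧ t ρ)
      fX = λ z → any (λ y → R z y 𝔹.∧ X y) (allFin 3)
      x≈⋁ : x ≈ ⋁ (map (λ j → ⌜ X j ⌝ ∧ P j) (allFin 3))
      x≈⋁ = trans (decompose x) (⋁-map-cong (⟦⟧-embed t ρ) (allFin 3))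

  module Fork (a : Carrier) where

    Pu Pv Pw : Carrier
    Pv = □ (f (□ a))
    Pw = ¬ f (□ a)
    Pu = ¬ (Pv ∨ Pw)

    Pu≤¬Pv : Pu ≤ (¬ Pv)
    Pu≤¬Pv = ¬-antimono-≤ (x≤x∨y Pv Pw)

    Pu≤¬Pw : Pu ≤ (¬ Pw)
    Pu≤¬Pw = ¬-antimono-≤ (y≤x∨y Pv Pw)

    fPw≈¬Pv : f Pw ≈ ¬ Pv
    fPw≈¬Pv = sym (¬-involutive _)

    fPv≤¬Pw : f Pv ≤ (¬ Pw)
    fPv≤¬Pw = ≤-respʳ-≈ (sym (¬-involutive _))
      (≤-trans (f-mono-≤ (□x≤x _)) (f-idem (□ a)))

    fPu≤¬Pw : f Pu ≤ (¬ Pw)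
    fPu≤¬Pw = ≤-trans (f-mono-≤ (≤-respʳ-≈ (¬-involutive _) Pu≤¬Pw))
      (≤-respʳ-≈ (sym (¬-involutive _)) (f-idem (□ a)))

    fPu≤¬Pv : f Pu ≤ (¬ Pv)
    fPu≤¬Pv = ≤-respʳ-≈ fPw≈¬Pv
      (≤-trans (f-mono-≤ (≤-respʳ-≈ (sym fPw≈¬Pv) Pu≤¬Pv)) (f-idem Pw))

    Pv≤¬Pw : Pv ≤ (¬ Pw)
    Pv≤¬Pw = ≤-respʳ-≈ (sym (¬-involutive _)) (□x≤x _)

    ¬Pw≤fPv : (¬ Pw) ≤ f Pv
    ¬Pw≤fPv = ≤-trans (≤-reflexive (¬-involutive _))
      (f-mono-≤ (≤-trans (□x≤□□x a) (□-mono-≤ (f-ext (□ a)))))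

    P : Fin 3 → Carrier
    P zero             = Pu
    P (suc zero)       = Pv
    P (suc (suc zero)) = Pw

    covers : ⋁ (map P (allFin 3)) ≈ ⊤
    covers = trans (∨-congˡ (∨-congˡ (∨-identityʳ Pw))) (∨-complementˡ (Pv ∨ Pw))

    disjoint : ∀ i j → P j ≈[ P i ] ⌜ does (i Fin.≟ j) ⌝
    disjoint zero             zero             = ≤⇒≈[]⊤ ≤-refl
    disjoint zero             (suc zero)       = ∧≈⊥⇒≈[]⊥ (trans (∧-comm _ _) (x≤¬y⇒x∧y≈⊥ Pu≤¬Pv))
    disjoint zero             (suc (suc zero)) = ∧≈⊥⇒≈[]⊥ (trans (∧-comm _ _) (x≤¬y⇒x∧y≈⊥ Pu≤¬Pw))
    disjoint (suc zero)       zero             = ∧≈⊥⇒≈[]⊥ (x≤¬y⇒x∧y≈⊥ Pu≤¬Pv)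
    disjoint (suc zero)       (suc zero)       = ≤⇒≈[]⊤ ≤-refl
    disjoint (suc zero)       (suc (suc zero)) = ∧≈⊥⇒≈[]⊥ (trans (∧-comm _ _) (x≤¬y⇒x∧y≈⊥ Pv≤¬Pw))
    disjoint (suc (suc zero)) zero             = ∧≈⊥⇒≈[]⊥ (x≤¬y⇒x∧y≈⊥ Pu≤¬Pw)
    disjoint (suc (suc zero)) (suc zero)       = ∧≈⊥⇒≈[]⊥ (x≤¬y⇒x∧y≈⊥ Pv≤¬Pw)
    disjoint (suc (suc zero)) (suc (suc zero)) = ≤⇒≈[]⊤ ≤-refl

    f-P : ∀ i j → f (P j) ≈[ P i ] ⌜ R i j ⌝
    f-P zero             zero             = ≤⇒≈[]⊤ (f-ext _)
    f-P zero             (suc zero)       = ≤⇒≈[]⊤ (≤-trans Pu≤¬Pw ¬Pw≤fPv)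
    f-P zero             (suc (suc zero)) = ≤⇒≈[]⊤ (≤-respʳ-≈ (sym fPw≈¬Pv) Pu≤¬Pv)
    f-P (suc zero)       zero             = ∧≈⊥⇒≈[]⊥ (x≤¬y⇒x∧y≈⊥ fPu≤¬Pv)
    f-P (suc zero)       (suc zero)       = ≤⇒≈[]⊤ (f-ext _)
    f-P (suc zero)       (suc (suc zero)) = ∧≈⊥⇒≈[]⊥ (x≤¬y⇒x∧y≈⊥ (≤-reflexive fPw≈¬Pv))
    f-P (suc (suc zero)) zero             = ∧≈⊥⇒≈[]⊥ (x≤¬y⇒x∧y≈⊥ fPu≤¬Pw)
    f-P (suc (suc zero)) (suc zero)       = ∧≈⊥⇒≈[]⊥ (x≤¬y⇒x∧y≈⊥ fPv≤¬Pw)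
    f-P (suc (suc zero)) (suc (suc zero)) = ≤⇒≈[]⊤ (f-ext _)

    open ForkPartition P covers disjoint f-P public

open import Relation.Nullary using (¬_)

𝟚∈𝕍 : ∀ {E} → Nontrivial E → 𝟚 ∈𝕍 E
𝟚∈𝕍 (A , A∈𝕍E , ⊤≉⊥) t s e ρ = ⌜⌝-injective ⊤≉⊥
  (trans (sym (⟦⟧-⌜⌝ t ρ)) (trans (A∈𝕍E t s e (⌜_⌝ ∘ ρ)) (⟦⟧-⌜⌝ s ρ)))
  where
  open ClosureAlgebra A
  open ClosureAlgebraProperties A

varBound : Term → ℕ
varBound (var k) = suc k
varBound 𝟘       = zero
varBound 𝟙       = zero
varBound (t ⊕ s) = varBound t ⊔ varBound s
varBound (t ⊙ s) = varBound t ⊔ varBound s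
varBound (⊖ t)   = varBound t
varBound (𝒇 t)   = varBound t

⟦⟧-𝟚-cong-below : ∀ t {ρ ρ′ : ℕ → Bool} →
                  (∀ {k} → k < varBound t → ρ k ≡ ρ′ k) → ⟦ 𝟚 ⟧ t ρ ≡ ⟦ 𝟚 ⟧ t ρ′
⟦⟧-𝟚-cong-below (var k) ρ≡ρ′ = ρ≡ρ′ (ℕP.n<1+n k)
⟦⟧-𝟚-cong-below 𝟘       ρ≡ρ′ = refl
⟦⟧-𝟚-cong-below 𝟙       ρ≡ρ′ = refl
⟦⟧-𝟚-cong-below (t ⊕ s) ρ≡ρ′ = cong₂ 𝔹._∨_
  (⟦⟧-𝟚-cong-below t (ρ≡ρ′ ∘ ℕP.m<n⇒m<n⊔o (varBound s)))
  (⟦⟧-𝟚-cong-below s (ρ≡ρ′ ∘ ℕP.m<n⇒m<o⊔n (varBound t)))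
⟦⟧-𝟚-cong-below (t ⊙ s) ρ≡ρ′ = cong₂ 𝔹._∧_
  (⟦⟧-𝟚-cong-below t (ρ≡ρ′ ∘ ℕP.m<n⇒m<n⊔o (varBound s)))
  (⟦⟧-𝟚-cong-below s (ρ≡ρ′ ∘ ℕP.m<n⇒m<o⊔n (varBound t)))
⟦⟧-𝟚-cong-below (⊖ t)   ρ≡ρ′ = cong not (⟦⟧-𝟚-cong-below t ρ≡ρ′)
⟦⟧-𝟚-cong-below (𝒇 t)   ρ≡ρ′ = ⟦⟧-𝟚-cong-below t ρ≡ρ′

extend : ∀ {n} → Vec Bool n → ℕ → Bool
extend []       _       = false
extend (b ∷ bs) zero    = b
extend (b ∷ bs) (suc k) = extend bs k

restrict : (ℕ → Bool) → ∀ n → Vec Bool n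
restrict ρ zero    = []
restrict ρ (suc n) = ρ zero ∷ restrict (ρ ∘ suc) n

extend-restrict : ∀ ρ n {k} → k < n → extend (restrict ρ n) k ≡ ρ k
extend-restrict ρ (suc n) {zero}  _         = refl
extend-restrict ρ (suc n) {suc k} (s<s k<n) = extend-restrict (ρ ∘ suc) n k<n

𝟚-valid-or-refutable : ∀ t → (𝟚 ⊨ t ≈ₜ 𝟙) ⊎ ∃ λ ρ → ⟦ 𝟚 ⟧ t ρ ≡ false
𝟚-valid-or-refutable t
  with anySubset? {n = varBound t} (λ bs → ⟦ 𝟚 ⟧ t (extend bs) BoolP.≟ false)
... | yes (bs , refuted) = inj₂ (extend bs , refuted)
... | no irrefutable     = inj₁ λ ρ → BoolP.¬-not λ t≡false → irrefutable
  (restrict ρ _ , ≡.trans (⟦⟧-𝟚-cong-below t (extend-restrict ρ _)) t≡false)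

-- In B_F, the point i sees only itself.
IsMaximal : Fin 3 → Set
IsMaximal i = ∀ X → lookup (fF X) i ≡ lookup X i

v-maximal : IsMaximal v
v-maximal (x ∷ y ∷ z ∷ []) = BoolP.∨-identityʳ y

w-maximal : IsMaximal w
w-maximal (x ∷ y ∷ z ∷ []) = BoolP.∨-identityʳ z

⟦B-F⟧-at-maximal : ∀ {i} → IsMaximal i → ∀ t ρ →
                   lookup (⟦ B-F ⟧ t ρ) i ≡ ⟦ 𝟚 ⟧ t (λ k → lookup (ρ k) i)
⟦B-F⟧-at-maximal {i} max (var k) ρ = refl
⟦B-F⟧-at-maximal {i} max 𝟘       ρ = VecP.lookup-replicate i false
⟦B-F⟧-at-maximal {i} max 𝟙       ρ = VecP.lookup-replicate i true
⟦B-F⟧-at-maximal {i} max (t ⊕ s) ρ =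
  ≡.trans (VecP.lookup-zipWith 𝔹._∨_ i (⟦ B-F ⟧ t ρ) (⟦ B-F ⟧ s ρ))
          (cong₂ 𝔹._∨_ (⟦B-F⟧-at-maximal max t ρ) (⟦B-F⟧-at-maximal max s ρ))
⟦B-F⟧-at-maximal {i} max (t ⊙ s) ρ =
  ≡.trans (VecP.lookup-zipWith 𝔹._∧_ i (⟦ B-F ⟧ t ρ) (⟦ B-F ⟧ s ρ))
          (cong₂ 𝔹._∧_ (⟦B-F⟧-at-maximal max t ρ) (⟦B-F⟧-at-maximal max s ρ))
⟦B-F⟧-at-maximal {i} max (⊖ t)   ρ =
  ≡.trans (VecP.lookup-map i not (⟦ B-F ⟧ t ρ)) (cong not (⟦B-F⟧-at-maximal max t ρ))
⟦B-F⟧-at-maximal {i} max (𝒇 t)   ρ =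
  ≡.trans (max (⟦ B-F ⟧ t ρ)) (⟦B-F⟧-at-maximal max t ρ)

any-true : ∀ {I : Set} (p : I → Bool) {j js} → j ∈ js → p j ≡ true → any p js ≡ true
any-true p {js = j ∷ js} (here refl) pj = cong (𝔹._∨ any p js) pj
any-true p {js = j ∷ js} (there j∈js) pj with p j
... | true  = refl
... | false = any-true p j∈js pj

f∂-refuted-at-predecessor : ∀ {i j} X → R i j ≡ true → lookup X j ≡ false →
                            lookup (∁ (fF (∁ X))) i ≡ false
f∂-refuted-at-predecessor {i} {j} X iRj Xj≡false = begin
  lookup (∁ (fF (∁ X))) i       ≡⟨ VecP.lookup-map i not (fF (∁ X)) ⟩
  not (lookup (fF (∁ X)) i)     ≡⟨ cong not (VecP.lookup∘tabulate (λ x → any (R∧∁X x) (allFin 3)) i) ⟩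
  not (any (R∧∁X i) (allFin 3)) ≡⟨ cong not (any-true (R∧∁X i) (∈-allFin j) Rij∧∁Xj) ⟩
  false                         ∎
  where
  open ≡.≡-Reasoning
  R∧∁X : Fin 3 → Fin 3 → Bool
  R∧∁X x y = R x y 𝔹.∧ lookup (∁ X) y
  Rij∧∁Xj : R∧∁X i j ≡ true
  Rij∧∁Xj = cong₂ 𝔹._∧_ iRj (≡.trans (VecP.lookup-map j not X) (cong not Xj≡false))

false≢true : false ≢ true
false≢true ()

f∂-join-refuted-at-root : ∀ X Y → lookup X v ≡ false → lookup Y w ≡ false →
                          lookup (∁ (fF (∁ X)) ∪ ∁ (fF (∁ Y))) u ≡ false
f∂-join-refuted-at-root X Y Xv≡false Yw≡false =
  ≡.trans (VecP.lookup-zipWith 𝔹._∨_ u (∁ (fF (∁ X))) (∁ (fF (∁ Y))))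
          (cong₂ 𝔹._∨_ (f∂-refuted-at-predecessor {u} {v} X refl Xv≡false)
                       (f∂-refuted-at-predecessor {u} {w} Y refl Yw≡false))

B-F∈𝕍⇒wdp : ∀ {E} → B-F ∈𝕍 E → WeakDisjunctionProperty E
B-F∈𝕍⇒wdp B-F∈𝕍E τ₁ τ₂ valid with 𝟚-valid-or-refutable τ₁ | 𝟚-valid-or-refutable τ₂
... | inj₁ 𝟚⊨τ₁ | _          = inj₁ 𝟚⊨τ₁
... | inj₂ _     | inj₁ 𝟚⊨τ₂ = inj₂ 𝟚⊨τ₂
... | inj₂ (ρ₁ , τ₁-refuted) | inj₂ (ρ₂ , τ₂-refuted) = ⊥-elim (false≢true (≡.trans
  (≡.sym (f∂-join-refuted-at-root (⟦ B-F ⟧ τ₁ ρ) (⟦ B-F ⟧ τ₂ ρ) τ₁-at-v τ₂-at-w))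
  (cong (λ Z → lookup Z u) (valid B-F B-F∈𝕍E ρ))))
  where
  -- v carries ρ₁ and w carries ρ₂; the value at u does not matter.
  ρ : ℕ → Subset 3
  ρ k = ρ₁ k ∷ ρ₁ k ∷ ρ₂ k ∷ []
  τ₁-at-v : lookup (⟦ B-F ⟧ τ₁ ρ) v ≡ false
  τ₁-at-v = ≡.trans (⟦B-F⟧-at-maximal v-maximal τ₁ ρ) τ₁-refuted
  τ₂-at-w : lookup (⟦ B-F ⟧ τ₂ ρ) w ≡ false
  τ₂-at-w = ≡.trans (⟦B-F⟧-at-maximal w-maximal τ₂ ρ) τ₂-refuted

forkTerm₁ forkTerm₂ : Term
forkTerm₁ = 𝒇 (𝒇∂ (var zero))
forkTerm₂ = 𝒇 (⊖ var zero)

-- Under σ, the left-hand side is by definition Pv ∨ Pw = ¬ Pu for a = σ zero.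
forkIdentity-from-root-failure :
  ∀ A t s → A ⊨ t ≈ₜ s → ∀ ρ → lookup (⟦ B-F ⟧ t ρ) u ≢ lookup (⟦ B-F ⟧ s ρ) u →
  A ⊨ 𝒇∂ forkTerm₁ ⊕ 𝒇∂ forkTerm₂ ≈ₜ 𝟙
forkIdentity-from-root-failure A t s A⊨t≈s ρ t≢s σ =
  ¬x≈⊥⇒x≈⊤ (⌜⌝-≈[]-≢⇒≈⊥ root-agrees t≢s)
  where
  open ClosureAlgebra A
  open ClosureAlgebraProperties A
  open Fork (σ zero)
  root-agrees : ⌜ lookup (⟦ B-F ⟧ t ρ) u ⌝ ≈[ Pu ] ⌜ lookup (⟦ B-F ⟧ s ρ) u ⌝
  root-agrees = trans (sym (⟦⟧-embed t ρ u))
    (trans (≈⇒≈[] (A⊨t≈s (embed ∘ ρ))) (⟦⟧-embed s ρ u))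

wdp⇒forkIdentity-fails : ∀ {E} → WeakDisjunctionProperty E →
                         ¬ (E ⊩ 𝒇∂ forkTerm₁ ⊕ 𝒇∂ forkTerm₂ ≈ₜ 𝟙)
wdp⇒forkIdentity-fails wdp valid with wdp forkTerm₁ forkTerm₂ valid
... | inj₁ 𝟚⊨forkTerm₁ = false≢true (𝟚⊨forkTerm₁ (λ _ → false))
... | inj₂ 𝟚⊨forkTerm₂ = false≢true (𝟚⊨forkTerm₂ (λ _ → true))

lookup-extensional : ∀ {n} {X Y : Subset n} → (∀ i → lookup X i ≡ lookup Y i) → X ≡ Y
lookup-extensional {X = X} {Y} X≗Y = ≡.trans (≡.sym (VecP.tabulate∘lookup X))
  (≡.trans (VecP.tabulate-cong X≗Y) (VecP.tabulate∘lookup Y))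

identities-of-𝕍-hold-in-B-F : ∀ {E} → Nontrivial E → WeakDisjunctionProperty E →
                              ∀ t s → E ⊩ t ≈ₜ s → B-F ⊨ t ≈ₜ s
identities-of-𝕍-hold-in-B-F nt wdp t s valid ρ = lookup-extensional λ where
    zero             → at-root
    (suc zero)       → at-maximal v-maximal
    (suc (suc zero)) → at-maximal w-maximal
  where
  at-maximal : ∀ {i} → IsMaximal i → lookup (⟦ B-F ⟧ t ρ) i ≡ lookup (⟦ B-F ⟧ s ρ) i
  at-maximal max = ≡.trans (⟦B-F⟧-at-maximal max t ρ)
    (≡.trans (valid 𝟚 (𝟚∈𝕍 nt) _) (≡.sym (⟦B-F⟧-at-maximal max s ρ)))
  at-root : lookup (⟦ B-F ⟧ t ρ) u ≡ lookup (⟦ B-F ⟧ s ρ) u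
  at-root with lookup (⟦ B-F ⟧ t ρ) u BoolP.≟ lookup (⟦ B-F ⟧ s ρ) u
  ... | yes t≡s = t≡s
  ... | no t≢s  = ⊥-elim (wdp⇒forkIdentity-fails wdp λ A A∈𝕍E →
                    forkIdentity-from-root-failure A t s (valid A A∈𝕍E) ρ t≢s)

mainTheorem4 : (E : Identities) → Nontrivial E →
    (WeakDisjunctionProperty E ⇔ EqBF⊆ E)
mainTheorem4 E nt = mk⇔ wdp⇒EqBF⊆ EqBF⊆⇒wdp
  where
  wdp⇒EqBF⊆ : WeakDisjunctionProperty E → EqBF⊆ E
  wdp⇒EqBF⊆ wdp A A∈EqB-F t s e = A∈EqB-F t s
    (identities-of-𝕍-hold-in-B-F nt wdp t s λ A′ A′∈𝕍E → A′∈𝕍E t s e)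
  EqBF⊆⇒wdp : EqBF⊆ E → WeakDisjunctionProperty E
  EqBF⊆⇒wdp EqB-F⊆𝕍E = B-F∈𝕍⇒wdp (EqB-F⊆𝕍E B-F λ _ _ → id)
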